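{- If a clutter $\mathcal{C}$ satisfies the tilde-full condition, then $\mathcal{C}$ is a weak tilde-invariant clutter.
   Context: A clutter on a finite set $E$ is a family of subsets none containing another (members: hyperedges). A transversal is an inclusion-minimal subset meeting every hyperedge; $\mathrm{bn}$ the minimum transversal size; $\mathrm{minb}$ the minimum-size transversals; minimum-transversal-covered means $\bigcup\mathrm{minb}(\mathcal{C})=E$. A fractional packing is $y:\mathcal{C}\to\mathbb{R}_{\ge0}$ with $\sum_{H\ni a}y(H)\le1$ for all $a$; a maximum fractional packing maximizes $\sum_Hy(H)$ (value $\mathrm{fpn}$); its support is $\{H:y(H)>0\}$. Integral blocking condition: $\mathrm{fpn}=\mathrm{bn}$. $\tilde{\mathcal{C}}=\{H\in\mathcal{C}:|H\cap B|=1\ \forall B\in\mathrm{minb}(\mathcal{C})\}$. Tilde-full condition: $\mathcal{C}$ is minimum-transversal-covered, satisfies the integral blocking condition, and every hyperedge of $\tilde{\mathcal{C}}$ is in the support of some maximum fractional packing of $\mathcal{C}$. A clutter is tilde-invariant if it equals its tilde clutter and satisfies the integral blocking condition; it is weak tilde-invariant if it satisfies the integral blocking condition and its tilde clutter is tilde-invariant.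
   Formalization: Fractional packings, and hence maximum fractional packings and their supports, take nonnegative rational values instead of values in $\mathbb{R}_{\ge0}$. -}

module Defs where

open import Data.Nat using (ℕ; zero; suc; _≤_)
open import Data.Integer using (+_)
open import Data.Rational using (ℚ; 0ℚ; 1ℚ; _+_; _/_) renaming (_≤_ to _≤ℚ_; _<_ to _<ℚ_)
open import Data.Fin using (Fin)
open import Data.Fin.Subset using (Subset; _∈_; _⊆_; _∩_; ∣_∣; Nonempty; inside; outside)
open import Data.Fin.Subset.Properties using (_∈?_)
open import Data.Vec using ([]; _∷_)
open import Data.List using (List; []; _∷_; map; _++_; foldr)
open import Data.Bool using (if_then_else_)
open import Data.Product using (Σ; _×_; ∃; ∃-syntax)
open import Relation.Nullary using (¬_; does)
open import Relation.Binary.PropositionalEquality using (_≡_)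
open import Function.Bundles using (_⇔_)

-- A family of subsets of the ground set E = Fin n, given as a predicate.
-- (Automatically finite, since Subset n is finite.)
Family : ℕ → Set₁
Family n = Subset n → Set

IsClutter : ∀ {n} → Family n → Set
IsClutter C = ∀ H H' → C H → C H' → H ⊆ H' → H ≡ H'

Meets : ∀ {n} → Family n → Subset n → Set
Meets C T = ∀ H → C H → Nonempty (H ∩ T)

Transversal : ∀ {n} → Family n → Subset n → Set
Transversal C T = Meets C T × (∀ T' → T' ⊆ T → Meets C T' → T' ≡ T)

MinB : ∀ {n} → Family n → Subset n → Set
MinB C B = Transversal C B × (∀ T → Transversal C T → ∣ B ∣ ≤ ∣ T ∣)

MinTransversalCovered : ∀ {n} → Family n → Set
MinTransversalCovered {n} C = ∀ (a : Fin n) → ∃[ B ] (MinB C B × a ∈ B)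

allSubsets : ∀ n → List (Subset n)
allSubsets zero = [] ∷ []
allSubsets (suc n) = map (outside ∷_) (allSubsets n) ++ map (inside ∷_) (allSubsets n)

sumℚ : List ℚ → ℚ
sumℚ = foldr _+_ 0ℚ

loadAt : ∀ {n} → (Subset n → ℚ) → Fin n → ℚ
loadAt {n} y a = sumℚ (map (λ H → if does (a ∈? H) then y H else 0ℚ) (allSubsets n))

value : ∀ {n} → (Subset n → ℚ) → ℚ
value {n} y = sumℚ (map y (allSubsets n))

-- Fractional packing y : C → ℚ≥0 (extended by 0 outside C).
FracPacking : ∀ {n} → Family n → (Subset n → ℚ) → Set
FracPacking {n} C y =
  (∀ H → 0ℚ ≤ℚ y H) × (∀ H → ¬ C H → y H ≡ 0ℚ) × (∀ (a : Fin n) → loadAt y a ≤ℚ 1ℚ)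

MaxFracPacking : ∀ {n} → Family n → (Subset n → ℚ) → Set
MaxFracPacking C y = FracPacking C y × (∀ z → FracPacking C z → value z ≤ℚ value y)

IntegralBlocking : ∀ {n} → Family n → Set
IntegralBlocking C =
  ∃[ y ] ∃[ B ] (MaxFracPacking C y × MinB C B × value y ≡ (+ ∣ B ∣) / 1)

tilde : ∀ {n} → Family n → Family n
tilde C H = C H × (∀ B → MinB C B → ∣ H ∩ B ∣ ≡ 1)

TildeFull : ∀ {n} → Family n → Set
TildeFull C =
  MinTransversalCovered C × IntegralBlocking C
  × (∀ H → tilde C H → ∃[ y ] (MaxFracPacking C y × 0ℚ <ℚ y H))

TildeInvariant : ∀ {n} → Family n → Set
TildeInvariant C = (∀ H → C H ⇔ tilde C H) × IntegralBlocking C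

WeakTildeInvariant : ∀ {n} → Family n → Set
WeakTildeInvariant C = IntegralBlocking C × TildeInvariant (tilde C)

-- Idea: a maximum fractional packing y and a minimum transversal B satisfy
-- value y ≤ Σ_H y(H)·|H ∩ B| ≤ |B| by double counting, and integral blocking
-- turns both inequalities into equalities.  Complementary slackness then puts
-- the support of every maximum packing inside the tilde clutter C̃, so C̃
-- inherits the maximum packing, the minimum transversals and the integral
-- blocking condition from C; and a hyperedge of C̃ lying in the support of a
-- maximum packing meets every minimum transversal of C̃ exactly once.
module Submission where

open import Defs
open import Data.Nat using (ℕ)

open import Data.Nat using (suc; z≤n; s≤s; _≤_; _<_; _≤?_)
import Data.Nat.Properties as ℕₚ
import Data.Nat.Coprimality as Coprime
import Data.Integer as ℤ
import Data.Integer.Properties as ℤₚ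
open import Data.Rational
  using (ℚ; 0ℚ; 1ℚ; _+_; _*_; _/_; mkℚ)
  renaming (_≤_ to _≤ℚ_; _<_ to _<ℚ_; nonNegative to ≥0⇒nonNegative; positive to >0⇒positive)
import Data.Rational.Properties as ℚₚ
open import Data.Fin as Fin using (Fin)
open import Data.Fin.Subset using (Subset; _∈_; _⊆_; _∩_; ∣_∣; Nonempty; inside; outside)
open import Data.Fin.Subset.Properties
  using (_∈?_; ⊆-antisym; p⊂q⇒∣p∣<∣q∣; x∈p⇒p-x⊂p)
open import Data.Vec using ([]; _∷_)
open import Data.List using (List; []; _∷_; map; tabulate; allFin)
open import Data.List.Properties using (map-tabulate)
open import Data.List.Relation.Unary.Any using (here; there)
import Data.List.Membership.Propositional as List
open import Data.List.Membership.Propositional.Properties using (∈-map⁺; ∈-++⁺ˡ; ∈-++⁺ʳ)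
open import Data.Bool using (Bool; true; false; if_then_else_; _∧_)
open import Data.Product using (_,_; proj₁; proj₂)
open import Function using (id; _∘_)
open import Function.Bundles using (_⇔_; mk⇔)
open import Relation.Nullary using (¬_; does; yes; no)
open import Relation.Nullary.Decidable using (decidable-stable)
open import Relation.Binary.PropositionalEquality
open import Algebra.Bundles using (CommutativeMonoid)
open import Algebra.Properties.CommutativeSemigroup
  (CommutativeMonoid.commutativeSemigroup ℚₚ.+-0-commutativeMonoid) using (interchange)

open ≡-Reasoning

≤∧≢⇒< : ∀ {p q} → p ≤ℚ q → p ≢ q → p <ℚ q
≤∧≢⇒< {p} {q} p≤q p≢q =
  decidable-stable (p ℚₚ.<? q) (λ p≮q → p≢q (ℚₚ.≤-antisym p≤q (ℚₚ.≮⇒≥ p≮q)))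

fromℕ : ℕ → ℚ
fromℕ m = ℤ.+ m / 1

fromℕ≡mkℚ : ∀ m → fromℕ m ≡ mkℚ (ℤ.+ m) 0 (Coprime.sym (Coprime.1-coprimeTo m))
fromℕ≡mkℚ m = ℚₚ.normalize-coprime (Coprime.sym (Coprime.1-coprimeTo m))

fromℕ-suc : ∀ m → fromℕ (suc m) ≡ 1ℚ + fromℕ m
-- The middle term is 1ℚ + fromℕ m with fromℕ m unfolded to its normal form mkℚ (+ m) 0 _.
fromℕ-suc m = begin
  fromℕ (suc m)                          ≡⟨ cong (λ z → (ℤ.+ 1 ℤ.+ z) / 1) (sym (ℤₚ.*-identityʳ (ℤ.+ m))) ⟩
  (ℤ.+ 1 ℤ.+ ℤ.+ m ℤ.* ℤ.+ 1) / 1        ≡⟨ cong (1ℚ +_) (sym (fromℕ≡mkℚ m)) ⟩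
  1ℚ + fromℕ m                           ∎

fromℕ-nonNeg : ∀ m → 0ℚ ≤ℚ fromℕ m
fromℕ-nonNeg m = ℚₚ.nonNegative⁻¹ (fromℕ m) {{ℚₚ.normalize-nonNeg m 1}}

fromℕ-<-suc : ∀ m → fromℕ m <ℚ fromℕ (suc m)
fromℕ-<-suc m = subst₂ _<ℚ_ (ℚₚ.+-identityˡ (fromℕ m)) (sym (fromℕ-suc m))
  (ℚₚ.+-monoˡ-< (fromℕ m) (ℚₚ.positive⁻¹ 1ℚ))

fromℕ-mono-≤ : ∀ {m k} → m ≤ k → fromℕ m ≤ℚ fromℕ k
fromℕ-mono-≤ {k = k} z≤n = fromℕ-nonNeg k
fromℕ-mono-≤ {suc m} {suc k} (s≤s m≤k) =
  subst₂ _≤ℚ_ (sym (fromℕ-suc m)) (sym (fromℕ-suc k)) (ℚₚ.+-monoʳ-≤ 1ℚ (fromℕ-mono-≤ m≤k))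

fromℕ-mono-< : ∀ {m k} → m < k → fromℕ m <ℚ fromℕ k
fromℕ-mono-< {m} m<k = ℚₚ.<-≤-trans (fromℕ-<-suc m) (fromℕ-mono-≤ m<k)

fromℕ-cancel-≤ : ∀ {m k} → fromℕ m ≤ℚ fromℕ k → m ≤ k
fromℕ-cancel-≤ {m} {k} le = decidable-stable (m ≤? k) λ m≰k →
  ℚₚ.<-irrefl refl (ℚₚ.<-≤-trans (fromℕ-mono-< (ℕₚ.≰⇒> m≰k)) le)

∑ : {A : Set} → List A → (A → ℚ) → ℚ
∑ xs f = sumℚ (map f xs)

syntax ∑ xs (λ x → e) = ∑[ x ← xs ] e

module _ {A : Set} where

  ∑-cong : ∀ (xs : List A) {f g : A → ℚ} → (∀ x → f x ≡ g x) → ∑ xs f ≡ ∑ xs g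
  ∑-cong []       f≗g = refl
  ∑-cong (x ∷ xs) f≗g = cong₂ _+_ (f≗g x) (∑-cong xs f≗g)

  ∑-zero : ∀ (xs : List A) → ∑[ _ ← xs ] 0ℚ ≡ 0ℚ
  ∑-zero []       = refl
  ∑-zero (x ∷ xs) = cong (0ℚ +_) (∑-zero xs)

  ∑-+ : ∀ (xs : List A) (f g : A → ℚ) → ∑[ x ← xs ] (f x + g x) ≡ ∑ xs f + ∑ xs g
  ∑-+ []       f g = refl
  ∑-+ (x ∷ xs) f g =
    trans (cong (f x + g x +_) (∑-+ xs f g)) (interchange (f x) (g x) (∑ xs f) (∑ xs g))

  ∑-*ˡ : ∀ (xs : List A) (c : ℚ) (f : A → ℚ) → ∑[ x ← xs ] (c * f x) ≡ c * ∑ xs f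
  ∑-*ˡ []       c f = sym (ℚₚ.*-zeroʳ c)
  ∑-*ˡ (x ∷ xs) c f =
    trans (cong (c * f x +_) (∑-*ˡ xs c f)) (sym (ℚₚ.*-distribˡ-+ c (f x) (∑ xs f)))

  ∑-mono-≤ : ∀ (xs : List A) {f g : A → ℚ} → (∀ x → f x ≤ℚ g x) → ∑ xs f ≤ℚ ∑ xs g
  ∑-mono-≤ []       f≤g = ℚₚ.≤-refl
  ∑-mono-≤ (x ∷ xs) f≤g = ℚₚ.+-mono-≤ (f≤g x) (∑-mono-≤ xs f≤g)

  ∑-mono-< : ∀ {xs : List A} {f g : A → ℚ} {x} →
             (∀ x → f x ≤ℚ g x) → x List.∈ xs → f x <ℚ g x → ∑ xs f <ℚ ∑ xs g
  ∑-mono-< {_ ∷ xs} f≤g (here refl) fx<gx = ℚₚ.+-mono-<-≤ fx<gx (∑-mono-≤ xs f≤g)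
  ∑-mono-< {x ∷ _}  f≤g (there x∈xs) fx<gx = ℚₚ.+-mono-≤-< (f≤g x) (∑-mono-< f≤g x∈xs fx<gx)

∑-comm : ∀ {A B : Set} (xs : List A) (ys : List B) (f : A → B → ℚ) →
         ∑[ x ← xs ] ∑[ y ← ys ] f x y ≡ ∑[ y ← ys ] ∑[ x ← xs ] f x y
∑-comm []       ys f = sym (∑-zero ys)
∑-comm (x ∷ xs) ys f =
  trans (cong (∑ ys (f x) +_) (∑-comm xs ys f)) (sym (∑-+ ys (f x) (λ y → ∑[ x ← xs ] f x y)))

χ : Bool → ℚ
χ b = if b then 1ℚ else 0ℚ

χ-∧ : ∀ (c : ℚ) (b b′ : Bool) → c * χ (b ∧ b′) ≡ χ b′ * (if b then c else 0ℚ)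
χ-∧ c true  true  = trans (ℚₚ.*-identityʳ c) (sym (ℚₚ.*-identityˡ c))
χ-∧ c true  false = trans (ℚₚ.*-zeroʳ c) (sym (ℚₚ.*-zeroˡ c))
χ-∧ c false true  = ℚₚ.*-zeroʳ c
χ-∧ c false false = ℚₚ.*-zeroʳ c

χ-*-≤ : ∀ (b : Bool) {c} → c ≤ℚ 1ℚ → χ b * c ≤ℚ χ b
χ-*-≤ true  {c} c≤1 = subst (_≤ℚ 1ℚ) (sym (ℚₚ.*-identityˡ c)) c≤1
χ-*-≤ false {c} _   = ℚₚ.≤-reflexive (ℚₚ.*-zeroˡ c)

indicator : ∀ {n} → Subset n → Fin n → ℚ
indicator p a = χ (does (a ∈? p))

does-∈?-∩ : ∀ {n} (a : Fin n) (p q : Subset n) → does (a ∈? p ∩ q) ≡ does (a ∈? p) ∧ does (a ∈? q)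
does-∈?-∩ Fin.zero    (inside  ∷ p) (inside  ∷ q) = refl
does-∈?-∩ Fin.zero    (inside  ∷ p) (outside ∷ q) = refl
does-∈?-∩ Fin.zero    (outside ∷ p) (inside  ∷ q) = refl
does-∈?-∩ Fin.zero    (outside ∷ p) (outside ∷ q) = refl
does-∈?-∩ (Fin.suc a) (_ ∷ p)       (_ ∷ q)       = does-∈?-∩ a p q

∈-allSubsets : ∀ {n} (p : Subset n) → p List.∈ allSubsets n
∈-allSubsets []                    = here refl
∈-allSubsets {suc n} (outside ∷ p) = ∈-++⁺ˡ (∈-map⁺ (outside ∷_) (∈-allSubsets p))
∈-allSubsets {suc n} (inside ∷ p)  =
  ∈-++⁺ʳ (map (outside ∷_) (allSubsets n)) (∈-map⁺ (inside ∷_) (∈-allSubsets p))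

nonempty⇒∣p∣>0 : ∀ {n} {p : Subset n} → Nonempty p → 1 ≤ ∣ p ∣
nonempty⇒∣p∣>0 (x , x∈p) = ℕₚ.≤-trans (s≤s z≤n) (p⊂q⇒∣p∣<∣q∣ (x∈p⇒p-x⊂p x∈p))

⊆∧∣p∣≥∣q∣⇒≡ : ∀ {n} {p q : Subset n} → p ⊆ q → ∣ q ∣ ≤ ∣ p ∣ → p ≡ q
⊆∧∣p∣≥∣q∣⇒≡ {p = p} p⊆q ∣q∣≤∣p∣ = ⊆-antisym p⊆q λ {x} x∈q → decidable-stable (x ∈? p) λ x∉p →
  ℕₚ.<⇒≱ (p⊂q⇒∣p∣<∣q∣ (p⊆q , x , x∈q , x∉p)) ∣q∣≤∣p∣

fromℕ∣p∣≡∑indicator : ∀ {n} (p : Subset n) → fromℕ ∣ p ∣ ≡ ∑[ a ← allFin n ] indicator p a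
fromℕ∣p∣≡∑indicator {n} p = trans (go p) (cong sumℚ (sym (map-tabulate id (indicator p))))
  where
  go : ∀ {m} (p : Subset m) → fromℕ ∣ p ∣ ≡ sumℚ (tabulate (indicator p))
  go []            = refl
  go (inside ∷ p)  = trans (fromℕ-suc ∣ p ∣) (cong (1ℚ +_) (go p))
  go (outside ∷ p) = trans (go p) (sym (ℚₚ.+-identityˡ _))

module Duality {n : ℕ} {C : Family n} {y : Subset n → ℚ} (packing : FracPacking C y) where

  private
    y≥0 : ∀ H → 0ℚ ≤ℚ y H
    y≥0 = proj₁ packing

    y-vanishes : ∀ H → ¬ C H → y H ≡ 0ℚ
    y-vanishes = proj₁ (proj₂ packing)

    load≤1 : ∀ a → loadAt y a ≤ℚ 1ℚ
    load≤1 = proj₂ (proj₂ packing)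

  module _ {T : Subset n} (meets : Meets C T) where

    weightedValue : ℚ
    weightedValue = ∑[ H ← allSubsets n ] (y H * fromℕ ∣ H ∩ T ∣)

    weightedValue≡∑load : weightedValue ≡ ∑[ a ← allFin n ] (indicator T a * loadAt y a)
    weightedValue≡∑load = begin
      ∑[ H ← S ] (y H * fromℕ ∣ H ∩ T ∣)
        ≡⟨ ∑-cong S (λ H → trans (cong (y H *_) (fromℕ∣p∣≡∑indicator (H ∩ T)))
                                 (sym (∑-*ˡ E (y H) (indicator (H ∩ T))))) ⟩
      ∑[ H ← S ] ∑[ a ← E ] (y H * indicator (H ∩ T) a)
        ≡⟨ ∑-comm S E (λ H a → y H * indicator (H ∩ T) a) ⟩
      ∑[ a ← E ] ∑[ H ← S ] (y H * indicator (H ∩ T) a)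
        ≡⟨ ∑-cong E (λ a → ∑-cong S (λ H → split a H)) ⟩
      ∑[ a ← E ] ∑[ H ← S ] (indicator T a * (if does (a ∈? H) then y H else 0ℚ))
        ≡⟨ ∑-cong E (λ a → ∑-*ˡ S (indicator T a) (λ H → if does (a ∈? H) then y H else 0ℚ)) ⟩
      ∑[ a ← E ] (indicator T a * loadAt y a)
        ∎
      where
      S = allSubsets n
      E = allFin n
      split : ∀ a H → y H * indicator (H ∩ T) a ≡ indicator T a * (if does (a ∈? H) then y H else 0ℚ)
      split a H = trans (cong (λ b → y H * χ b) (does-∈?-∩ a H T)) (χ-∧ (y H) (does (a ∈? H)) (does (a ∈? T)))

    weightedValue≤∣T∣ : weightedValue ≤ℚ fromℕ ∣ T ∣
    weightedValue≤∣T∣ = subst₂ _≤ℚ_ (sym weightedValue≡∑load) (sym (fromℕ∣p∣≡∑indicator T))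
      (∑-mono-≤ (allFin n) (λ a → χ-*-≤ (does (a ∈? T)) (load≤1 a)))

    support-meets : ∀ H → y H ≢ 0ℚ → 1 ≤ ∣ H ∩ T ∣
    support-meets H y≢0 = decidable-stable (1 ≤? ∣ H ∩ T ∣) λ ∣H∩T∣≱1 →
      y≢0 (y-vanishes H (λ CH → ∣H∩T∣≱1 (nonempty⇒∣p∣>0 (meets H CH))))

    y≤weighted : ∀ H → y H ≤ℚ y H * fromℕ ∣ H ∩ T ∣
    y≤weighted H with y H ℚₚ.≟ 0ℚ
    ... | yes y≡0 = ℚₚ.≤-reflexive (trans y≡0 (sym (trans (cong (_* w) y≡0) (ℚₚ.*-zeroˡ w))))
      where w = fromℕ ∣ H ∩ T ∣
    ... | no  y≢0 = subst (_≤ℚ y H * fromℕ ∣ H ∩ T ∣) (ℚₚ.*-identityʳ (y H))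
      (ℚₚ.*-monoˡ-≤-nonNeg (y H) {{≥0⇒nonNegative (y≥0 H)}} (fromℕ-mono-≤ (support-meets H y≢0)))

    weak-duality : value y ≤ℚ fromℕ ∣ T ∣
    weak-duality = ℚₚ.≤-trans (∑-mono-≤ (allSubsets n) y≤weighted) weightedValue≤∣T∣

    complementary-slackness : value y ≡ fromℕ ∣ T ∣ → ∀ H → 0ℚ <ℚ y H → ∣ H ∩ T ∣ ≡ 1
    complementary-slackness tight H y>0 = ℕₚ.≤-antisym ∣H∩T∣≤1 (support-meets H (ℚₚ.<⇒≢ y>0 ∘ sym))
      where
      ∣H∩T∣≤1 : ∣ H ∩ T ∣ ≤ 1
      ∣H∩T∣≤1 = decidable-stable (∣ H ∩ T ∣ ≤? 1) λ ∣H∩T∣≰1 →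
        ℚₚ.<-irrefl tight (ℚₚ.<-≤-trans
          (∑-mono-< {g = λ H → y H * fromℕ ∣ H ∩ T ∣} y≤weighted (∈-allSubsets H)
            (subst (_<ℚ y H * fromℕ ∣ H ∩ T ∣) (ℚₚ.*-identityʳ (y H))
              (ℚₚ.*-monoʳ-<-pos (y H) {{>0⇒positive y>0}} (fromℕ-mono-< (ℕₚ.≰⇒> ∣H∩T∣≰1)))))
          weightedValue≤∣T∣)

open Duality using (weak-duality; complementary-slackness)

module _ {n : ℕ} {C : Family n} where

  minB-size-unique : ∀ {B B′} → MinB C B → MinB C B′ → ∣ B ∣ ≡ ∣ B′ ∣
  minB-size-unique (trB , minB) (trB′ , minB′) = ℕₚ.≤-antisym (minB _ trB′) (minB′ _ trB)

  maxFracPacking-value-unique : ∀ {y z} → MaxFracPacking C y → MaxFracPacking C z → value y ≡ value z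
  maxFracPacking-value-unique (py , maxy) (pz , maxz) = ℚₚ.≤-antisym (maxz _ py) (maxy _ pz)

  integralBlocking⇒value≡∣B∣ : IntegralBlocking C → ∀ {y B} → MaxFracPacking C y → MinB C B →
                               value y ≡ fromℕ ∣ B ∣
  integralBlocking⇒value≡∣B∣ (y₀ , B₀ , max₀ , minB₀ , val₀) {y} {B} maxy minB = begin
    value y        ≡⟨ maxFracPacking-value-unique maxy max₀ ⟩
    value y₀       ≡⟨ val₀ ⟩
    fromℕ ∣ B₀ ∣   ≡⟨ cong fromℕ (minB-size-unique minB₀ minB) ⟩
    fromℕ ∣ B ∣    ∎

module _ {n : ℕ} {C D : Family n} (D⊆C : ∀ {H} → D H → C H) where

  fracPacking-⊇ : ∀ {z} → FracPacking D z → FracPacking C z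
  fracPacking-⊇ (z≥0 , z-vanishes , load≤1) = z≥0 , (λ H ¬CH → z-vanishes H (¬CH ∘ D⊆C)) , load≤1

  maxFracPacking-restrict : ∀ {y} → MaxFracPacking C y → FracPacking D y → MaxFracPacking D y
  maxFracPacking-restrict (_ , maxy) packingD = packingD , λ z packingz → maxy z (fracPacking-⊇ packingz)

  integralBlocking-restrict : (∀ {y} → MaxFracPacking C y → FracPacking D y) →
                              IntegralBlocking C → IntegralBlocking D
  integralBlocking-restrict max⇒packingD (y₀ , B₀ , max₀ , minB₀ , val₀) =
    y₀ , B₀ , maxFracPacking-restrict max₀ (max⇒packingD max₀) , minB₀-D , val₀
    where
    ∣B₀∣≤ : ∀ {T} → Meets D T → ∣ B₀ ∣ ≤ ∣ T ∣
    ∣B₀∣≤ meets = fromℕ-cancel-≤ (subst (_≤ℚ _) val₀ (weak-duality (max⇒packingD max₀) meets))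

    minB₀-D : MinB D B₀
    minB₀-D = (meets , minimal) , λ T (meetsT , _) → ∣B₀∣≤ meetsT
      where
      meets : Meets D B₀
      meets H DH = proj₁ (proj₁ minB₀) H (D⊆C DH)
      minimal : ∀ T → T ⊆ B₀ → Meets D T → T ≡ B₀
      minimal T T⊆B₀ meetsT = ⊆∧∣p∣≥∣q∣⇒≡ T⊆B₀ (∣B₀∣≤ meetsT)

maxFracPacking⇒fracPacking-tilde : ∀ {n} {C : Family n} → IntegralBlocking C →
                                   ∀ {y} → MaxFracPacking C y → FracPacking (tilde C) y
maxFracPacking⇒fracPacking-tilde ib {y} maxy@((y≥0 , y-vanishes , load≤1) , _) =
  y≥0 , vanishes , load≤1
  where
  vanishes : ∀ H → ¬ tilde _ H → y H ≡ 0ℚ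
  vanishes H ¬H~ = decidable-stable (y H ℚₚ.≟ 0ℚ) λ y≢0 → y≢0 (y-vanishes H λ CH →
    ¬H~ (CH , λ B minB → complementary-slackness (proj₁ maxy) (proj₁ (proj₁ minB))
                           (integralBlocking⇒value≡∣B∣ ib maxy minB) H
                           (≤∧≢⇒< (y≥0 H) (y≢0 ∘ sym))))

lemma3p14 : (n : ℕ) (C : Family n) → IsClutter C → TildeFull C → WeakTildeInvariant C
lemma3p14 n C _ (_ , ib , tilde-supported) = ib , tilde-closed , ib~
  where
  packing~ : ∀ {y} → MaxFracPacking C y → FracPacking (tilde C) y
  packing~ = maxFracPacking⇒fracPacking-tilde ib

  ib~ : IntegralBlocking (tilde C)
  ib~ = integralBlocking-restrict proj₁ packing~ ib

  meets-once : ∀ {H} → tilde C H → ∀ B → MinB (tilde C) B → ∣ H ∩ B ∣ ≡ 1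
  meets-once {H} H~ B minB with tilde-supported H H~
  ... | y , maxy , y>0 =
    complementary-slackness (packing~ maxy) (proj₁ (proj₁ minB))
      (integralBlocking⇒value≡∣B∣ ib~ (maxFracPacking-restrict proj₁ maxy (packing~ maxy)) minB) H y>0

  tilde-closed : ∀ H → tilde C H ⇔ tilde (tilde C) H
  tilde-closed H = mk⇔ (λ H~ → H~ , meets-once H~) proj₁
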